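{- For all non-bipartite graphs $\mathcal{G}$ and bipartite graphs $\mathcal{H}$, $V^0$ proves that there is no homomorphism from $\mathcal{G}$ to $\mathcal{H}$: $$V^0\vdash\forall\mathcal{G},\mathcal{H}\,\big(BIP(\mathcal{H})\wedge NONBIP(\mathcal{G})\to\neg HOM(\mathcal{G},\mathcal{H})\big).$$
   Context: $V^0$ is the two-sorted first-order theory over the vocabulary $\mathcal{L}^2_{PA}=\{0,1,+,\cdot,|\cdot|;=_1,=_2,\leq,\in\}$, with number variables (ranging over $\mathbb{N}$) and string (finite set) variables ranging over finite subsets of $\mathbb{N}$; $|X|$ denotes the least upper bound of $X$ and $X(t)$ abbreviates $t\in X$. $V^0$ is axiomatized by the standard basic axioms 2-BASIC and the comprehension scheme $\Sigma^B_0$-COMP: $\exists X\leq y\,\forall z<y\,(X(z)\leftrightarrow\varphi(z))$ for every formula $\varphi$ whose only quantifiers are bounded number quantifiers. A bounded string quantifier $\exists X\leq t$ means $\exists X(|X|\leq t\wedge\dots)$. Divisibility: $x|y\leftrightarrow\exists z\leq y\,(x\cdot z=y)$. The pairing function is $\langle x,y\rangle=(x+y)(x+y+1)+2y$, and $E(i,j)$ abbreviates $E(\langle i,j\rangle)$. A graph is a pair of strings $\mathcal{G}=(V_\mathcal{G},E_\mathcal{G})$ with $|V_\mathcal{G}|=n$ satisfying $\forall i<n\,V_\mathcal{G}(i)\wedge\forall i<j<n\,(E_\mathcal{G}(i,j)\leftrightarrow E_\mathcal{G}(j,i))\wedge\forall i<n\,\neg E_\mathcal{G}(i,i)$; quantification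 over graphs is over such pairs. $MAP(n,m,Z):\ \forall i<n\,\exists j<m\,Z(\langle i,j\rangle)\wedge\forall i<n\,\forall j_1,j_2<m\,(Z(\langle i,j_1\rangle)\wedge Z(\langle i,j_2\rangle)\to j_1=j_2)$. For graphs with $|V_\mathcal{G}|=n$, $|V_\mathcal{H}|=m$: $HOM(\mathcal{G},\mathcal{H}):\ \exists Z\leq\langle n-1,m-1\rangle\,\big(MAP(n,m,Z)\wedge\forall i_1,i_2<n\,\forall j_1,j_2<m\,(E_\mathcal{G}(i_1,i_2)\wedge Z(\langle i_1,j_1\rangle)\wedge Z(\langle i_2,j_2\rangle)\to E_\mathcal{H}(j_1,j_2))\big)$. $BIP(\mathcal{H}):\ \exists W_\mathcal{H},U_\mathcal{H}\leq m\,\big(\forall i<m\,(W_\mathcal{H}(i)\leftrightarrow\neg U_\mathcal{H}(i))\wedge\forall i<j<m\,(E_\mathcal{H}(i,j)\to(W_\mathcal{H}(i)\wedge U_\mathcal{H}(j))\vee(W_\mathcal{H}(j)\wedge U_\mathcal{H}(i)))\big)$. For a pair $\mathcal{C}_k=(V_{\mathcal{C}_k},E_{\mathcal{C}_k})$ with $|V_{\mathcal{C}_k}|=k$: $CYCLE(\mathcal{C}_k):\ E_{\mathcal{C}_k}(0,k-1)\wedge\forall i<k-1\,E_{\mathcal{C}_k}(i,i+1)\wedge\forall i,j<k-1\,(j\neq i+1\to\neg E_{\mathcal{C}_k}(i,j))$. $NONBIP(\mathcal{G}):\ \exists k\leq n\,\big(2|(k-1)\wedge\exists V_{\mathcal{C}_k}\,(|V_{\mathcal{C}_k}|=k)\,\exists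 E_{\mathcal{C}_k}\,(|E_{\mathcal{C}_k}|<4k^2)\,(CYCLE(V_{\mathcal{C}_k},E_{\mathcal{C}_k})\wedge HOM(\mathcal{C}_k,\mathcal{G}))\big)$. -}

module Defs where

-- Deep embedding of the two-sorted theory V^0 (Cook--Nguyen) over
-- L^2_PA = {0,1,+,·,|·| ; =1, =2, ≤, ∈}, a classical natural-deduction
-- calculus for two-sorted first-order logic with equality, the axioms
-- 2-BASIC and the Σ^B_0-COMP scheme, and the sentence of the theorem.
-- Variables are de Bruijn indices (ℕ), separately for each sort.

open import Data.Nat using (ℕ; zero; suc; _∸_)
open import Data.List using (List; []; _∷_; map)
open import Data.List.Membership.Propositional using (_∈_)

data STm : Set where
  svar : ℕ → STm

data NTm : Set where
  nvar : ℕ → NTm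
  `0 `1 : NTm
  _⊕_ _⊗_ : NTm → NTm → NTm
  len : STm → NTm

infixl 6 _⊕_
infixl 7 _⊗_

data Form : Set where
  _≐_   : NTm → NTm → Form
  _≐ₛ_  : STm → STm → Form
  _≼_   : NTm → NTm → Form
  _∈ₛ_  : NTm → STm → Form    -- t ∈ X, i.e. X(t)
  ⊥f    : Form
  _∧f_ _∨f_ _⇒f_ : Form → Form → Form
  ∀n ∃n ∀s ∃s : Form → Form

infixr 3 _∧f_
infixr 2 _∨f_
infixr 1 _⇒f_

¬f : Form → Form
¬f φ = φ ⇒f ⊥f

_⇔f_ : Form → Form → Form
φ ⇔f ψ = (φ ⇒f ψ) ∧f (ψ ⇒f φ)

_≺_ : NTm → NTm → Form
t ≺ u = (t ≼ u) ∧f ¬f (t ≐ u)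

liftR : (ℕ → ℕ) → ℕ → ℕ
liftR ρ zero    = zero
liftR ρ (suc k) = suc (ρ k)

renS : (ℕ → ℕ) → STm → STm
renS σ (svar k) = svar (σ k)

-- ρ renames number variables, σ renames string variables
renN : (ℕ → ℕ) → (ℕ → ℕ) → NTm → NTm
renN ρ σ (nvar k) = nvar (ρ k)
renN ρ σ `0 = `0
renN ρ σ `1 = `1
renN ρ σ (t ⊕ u) = renN ρ σ t ⊕ renN ρ σ u
renN ρ σ (t ⊗ u) = renN ρ σ t ⊗ renN ρ σ u
renN ρ σ (len X) = len (renS σ X)

renF : (ℕ → ℕ) → (ℕ → ℕ) → Form → Form
renF ρ σ (t ≐ u) = renN ρ σ t ≐ renN ρ σ u
renF ρ σ (X ≐ₛ Y) = renS σ X ≐ₛ renS σ Y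
renF ρ σ (t ≼ u) = renN ρ σ t ≼ renN ρ σ u
renF ρ σ (t ∈ₛ X) = renN ρ σ t ∈ₛ renS σ X
renF ρ σ ⊥f = ⊥f
renF ρ σ (φ ∧f ψ) = renF ρ σ φ ∧f renF ρ σ ψ
renF ρ σ (φ ∨f ψ) = renF ρ σ φ ∨f renF ρ σ ψ
renF ρ σ (φ ⇒f ψ) = renF ρ σ φ ⇒f renF ρ σ ψ
renF ρ σ (∀n φ) = ∀n (renF (liftR ρ) σ φ)
renF ρ σ (∃n φ) = ∃n (renF (liftR ρ) σ φ)
renF ρ σ (∀s φ) = ∀s (renF ρ (liftR σ) φ)
renF ρ σ (∃s φ) = ∃s (renF ρ (liftR σ) φ)

idR : ℕ → ℕ
idR k = k

↑n : Form → Form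
↑n = renF suc idR

↑s : Form → Form
↑s = renF idR suc

↑t : NTm → NTm
↑t = renN suc idR

subN : (ℕ → NTm) → NTm → NTm
subN τ (nvar k) = τ k
subN τ `0 = `0
subN τ `1 = `1
subN τ (t ⊕ u) = subN τ t ⊕ subN τ u
subN τ (t ⊗ u) = subN τ t ⊗ subN τ u
subN τ (len X) = len X

liftSubN : (ℕ → NTm) → ℕ → NTm
liftSubN τ zero    = nvar zero
liftSubN τ (suc k) = renN suc idR (τ k)

liftSubS : (ℕ → NTm) → ℕ → NTm
liftSubS τ k = renN idR suc (τ k)

subF : (ℕ → NTm) → Form → Form
subF τ (t ≐ u) = subN τ t ≐ subN τ u
subF τ (X ≐ₛ Y) = X ≐ₛ Y
subF τ (t ≼ u) = subN τ t ≼ subN τ u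
subF τ (t ∈ₛ X) = subN τ t ∈ₛ X
subF τ ⊥f = ⊥f
subF τ (φ ∧f ψ) = subF τ φ ∧f subF τ ψ
subF τ (φ ∨f ψ) = subF τ φ ∨f subF τ ψ
subF τ (φ ⇒f ψ) = subF τ φ ⇒f subF τ ψ
subF τ (∀n φ) = ∀n (subF (liftSubN τ) φ)
subF τ (∃n φ) = ∃n (subF (liftSubN τ) φ)
subF τ (∀s φ) = ∀s (subF (liftSubS τ) φ)
subF τ (∃s φ) = ∃s (subF (liftSubS τ) φ)

-- φ[0 := t] for number variable 0 (other variables shift down)
inst : NTm → ℕ → NTm
inst t zero    = t
inst t (suc k) = nvar k

_[_]n : Form → NTm → Form
φ [ t ]n = subF (inst t) φ

-- φ[0 := X] for string variable 0 (string terms are variables)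
instS : ℕ → ℕ → ℕ
instS j zero    = j
instS j (suc k) = k

_[_]s : Form → ℕ → Form
φ [ j ]s = renF idR (instS j) φ

-- Higher-order builder for closed formulas (de Bruijn levels → indices).
-- A builder is evaluated at the current depths (number, string).

BN : Set
BN = ℕ → ℕ → NTm

BS : Set
BS = ℕ → ℕ → STm

BF : Set
BF = ℕ → ℕ → Form

`all : (BN → BF) → BF
`all f dn ds = ∀n (f (λ dn' _ → nvar (dn' ∸ suc dn)) (suc dn) ds)

`ex : (BN → BF) → BF
`ex f dn ds = ∃n (f (λ dn' _ → nvar (dn' ∸ suc dn)) (suc dn) ds)

`allS : (BS → BF) → BF
`allS f dn ds = ∀s (f (λ _ ds' → svar (ds' ∸ suc ds)) dn (suc ds))

`exS : (BS → BF) → BF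
`exS f dn ds = ∃s (f (λ _ ds' → svar (ds' ∸ suc ds)) dn (suc ds))

`z `o : BN
`z _ _ = `0
`o _ _ = `1

_+'_ _·'_ : BN → BN → BN
(t +' u) dn ds = t dn ds ⊕ u dn ds
(t ·' u) dn ds = t dn ds ⊗ u dn ds
infixl 6 _+'_
infixl 7 _·'_

∣_∣' : BS → BN
∣ X ∣' dn ds = len (X dn ds)

_==_ _≤'_ _<'_ : BN → BN → BF
(t == u) dn ds = t dn ds ≐ u dn ds
infix 4 _==_ _≤'_ _<'_ _==ₛ_ _∋'_
(t ≤' u) dn ds = t dn ds ≼ u dn ds
(t <' u) dn ds = t dn ds ≺ u dn ds

_==ₛ_ : BS → BS → BF
(X ==ₛ Y) dn ds = X dn ds ≐ₛ Y dn ds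

_∋'_ : BS → BN → BF
(X ∋' t) dn ds = t dn ds ∈ₛ X dn ds

_&_ _∨'_ _⟹_ _⟺_ : BF → BF → BF
(φ & ψ) dn ds = φ dn ds ∧f ψ dn ds
(φ ∨' ψ) dn ds = φ dn ds ∨f ψ dn ds
(φ ⟹ ψ) dn ds = φ dn ds ⇒f ψ dn ds
(φ ⟺ ψ) dn ds = φ dn ds ⇔f ψ dn ds
infixr 3 _&_
infixr 2 _∨'_
infixr 1 _⟹_ _⟺_

neg : BF → BF
neg φ dn ds = ¬f (φ dn ds)

all< ex< all≤ ex≤ : BN → (BN → BF) → BF
all< t f = `all λ x → x <' t ⟹ f x
ex<  t f = `ex  λ x → x <' t & f x
all≤ t f = `all λ x → x ≤' t ⟹ f x
ex≤  t f = `ex  λ x → x ≤' t & f x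

closed : BF → Form
closed φ = φ 0 0

-- 2-BASIC (Cook--Nguyen, Logical Foundations of Proof Complexity)

basicAxioms : List Form
basicAxioms = map closed
  ( (`all λ x → neg (x +' `o == `z))
  ∷ (`all λ x → `all λ y → x +' `o == y +' `o ⟹ x == y)
  ∷ (`all λ x → x +' `z == x)
  ∷ (`all λ x → `all λ y → x +' (y +' `o) == (x +' y) +' `o)
  ∷ (`all λ x → x ·' `z == `z)
  ∷ (`all λ x → `all λ y → x ·' (y +' `o) == (x ·' y) +' x)
  ∷ (`all λ x → `all λ y → (x ≤' y & y ≤' x) ⟹ x == y)
  ∷ (`all λ x → `all λ y → x ≤' x +' y)
  ∷ (`all λ x → `z ≤' x)
  ∷ (`all λ x → `all λ y → x ≤' y ∨' y ≤' x)
  ∷ (`all λ x → `all λ y → x ≤' y ⟺ x <' y +' `o)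
  ∷ (`all λ x → neg (x == `z) ⟹ ex≤ x (λ y → y +' `o == x))
  ∷ (`allS λ X → `all λ y → X ∋' y ⟹ y <' ∣ X ∣')
  ∷ (`allS λ X → `all λ y → y +' `o == ∣ X ∣' ⟹ X ∋' y)
  ∷ (`allS λ X → `allS λ Y →
       (∣ X ∣' == ∣ Y ∣' & all< ∣ X ∣' (λ i → X ∋' i ⟺ Y ∋' i)) ⟹ X ==ₛ Y)
  ∷ [])

-- Σ^B_0 formulas: only bounded number quantifiers ∀x≤t, ∃x≤t (x not in t)

data IsΣB0 : Form → Set where
  eqN  : ∀ t u → IsΣB0 (t ≐ u)
  eqS  : ∀ X Y → IsΣB0 (X ≐ₛ Y)
  leq  : ∀ t u → IsΣB0 (t ≼ u)
  mem  : ∀ t X → IsΣB0 (t ∈ₛ X)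
  bot  : IsΣB0 ⊥f
  conj : ∀ {φ ψ} → IsΣB0 φ → IsΣB0 ψ → IsΣB0 (φ ∧f ψ)
  disj : ∀ {φ ψ} → IsΣB0 φ → IsΣB0 ψ → IsΣB0 (φ ∨f ψ)
  impl : ∀ {φ ψ} → IsΣB0 φ → IsΣB0 ψ → IsΣB0 (φ ⇒f ψ)
  ball : ∀ t {φ} → IsΣB0 φ → IsΣB0 (∀n ((nvar 0 ≼ ↑t t) ⇒f φ))
  bex  : ∀ t {φ} → IsΣB0 φ → IsΣB0 (∃n ((nvar 0 ≼ ↑t t) ∧f φ))

-- Σ^B_0-COMP instance  ∀y ∃X≤y ∀z<y (X(z) ↔ φ(z)),
-- φ(z) with z = number variable 0 and arbitrary parameters; X not in φ.
compInst : Form → Form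
compInst φ =
  ∀n (∃s ((len (svar 0) ≼ nvar 0) ∧f
    ∀n ((nvar 0 ≺ nvar 1) ⇒f ((nvar 0 ∈ₛ svar 0) ⇔f renF (liftR (λ k → suc k)) suc φ))))

data V0Axiom : Form → Set where
  basic : ∀ {φ} → φ ∈ basicAxioms → V0Axiom φ
  comp  : ∀ φ → IsΣB0 φ → V0Axiom (compInst φ)

infix 0 _⊢V0_
infix 4 _≐_ _≐ₛ_ _≼_ _∈ₛ_ _≺_
data _⊢V0_ (Γ : List Form) : Form → Set where
  hyp   : ∀ {φ} → φ ∈ Γ → Γ ⊢V0 φ
  ax    : ∀ {φ} → V0Axiom φ → Γ ⊢V0 φ
  raa   : ∀ {φ} → (¬f φ ∷ Γ) ⊢V0 ⊥f → Γ ⊢V0 φ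
  ⇒I    : ∀ {φ ψ} → (φ ∷ Γ) ⊢V0 ψ → Γ ⊢V0 φ ⇒f ψ
  ⇒E    : ∀ {φ ψ} → Γ ⊢V0 φ ⇒f ψ → Γ ⊢V0 φ → Γ ⊢V0 ψ
  ∧I    : ∀ {φ ψ} → Γ ⊢V0 φ → Γ ⊢V0 ψ → Γ ⊢V0 φ ∧f ψ
  ∧E₁   : ∀ {φ ψ} → Γ ⊢V0 φ ∧f ψ → Γ ⊢V0 φ
  ∧E₂   : ∀ {φ ψ} → Γ ⊢V0 φ ∧f ψ → Γ ⊢V0 ψ
  ∨I₁   : ∀ {φ ψ} → Γ ⊢V0 φ → Γ ⊢V0 φ ∨f ψ
  ∨I₂   : ∀ {φ ψ} → Γ ⊢V0 ψ → Γ ⊢V0 φ ∨f ψ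
  ∨E    : ∀ {φ ψ χ} → Γ ⊢V0 φ ∨f ψ → (φ ∷ Γ) ⊢V0 χ → (ψ ∷ Γ) ⊢V0 χ → Γ ⊢V0 χ
  ∀nI   : ∀ {φ} → map ↑n Γ ⊢V0 φ → Γ ⊢V0 ∀n φ
  ∀nE   : ∀ {φ} t → Γ ⊢V0 ∀n φ → Γ ⊢V0 φ [ t ]n
  ∃nI   : ∀ {φ} t → Γ ⊢V0 φ [ t ]n → Γ ⊢V0 ∃n φ
  ∃nE   : ∀ {φ ψ} → Γ ⊢V0 ∃n φ → (φ ∷ map ↑n Γ) ⊢V0 ↑n ψ → Γ ⊢V0 ψ
  ∀sI   : ∀ {φ} → map ↑s Γ ⊢V0 φ → Γ ⊢V0 ∀s φ
  ∀sE   : ∀ {φ} j → Γ ⊢V0 ∀s φ → Γ ⊢V0 φ [ j ]s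
  ∃sI   : ∀ {φ} j → Γ ⊢V0 φ [ j ]s → Γ ⊢V0 ∃s φ
  ∃sE   : ∀ {φ ψ} → Γ ⊢V0 ∃s φ → (φ ∷ map ↑s Γ) ⊢V0 ↑s ψ → Γ ⊢V0 ψ
  reflN : ∀ t → Γ ⊢V0 t ≐ t
  substN : ∀ {φ t u} → Γ ⊢V0 t ≐ u → Γ ⊢V0 φ [ t ]n → Γ ⊢V0 φ [ u ]n
  reflS : ∀ j → Γ ⊢V0 svar j ≐ₛ svar j
  substS : ∀ {φ i j} → Γ ⊢V0 svar i ≐ₛ svar j → Γ ⊢V0 φ [ i ]s → Γ ⊢V0 φ [ j ]s

V0⊢ : Form → Set
V0⊢ φ = [] ⊢V0 φ

⟨_,_⟩ : BN → BN → BN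
⟨ x , y ⟩ = (x +' y) ·' ((x +' y) +' `o) +' (`o +' `o) ·' y

two four : BN
two  = `o +' `o
four = ((`o +' `o) +' `o) +' `o

-- p = a - 1 (truncated subtraction; the vocabulary has no '-')
IsPred : BN → BN → BF
IsPred a p = (a == `z & p == `z) ∨' (p +' `o == a)

Divides : BN → BN → BF
Divides x y = ex≤ y λ z → x ·' z == y

IsGraph : BS → BS → BF
IsGraph V E =
  all< ∣ V ∣' (λ i → V ∋' i) &
  all< ∣ V ∣' (λ j → all< j λ i → E ∋' ⟨ i , j ⟩ ⟺ E ∋' ⟨ j , i ⟩) &
  all< ∣ V ∣' (λ i → neg (E ∋' ⟨ i , i ⟩))

MAP : BN → BN → BS → BF
MAP n m Z =
  all< n (λ i → ex< m λ j → Z ∋' ⟨ i , j ⟩) &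
  all< n (λ i → all< m λ j₁ → all< m λ j₂ →
    (Z ∋' ⟨ i , j₁ ⟩ & Z ∋' ⟨ i , j₂ ⟩) ⟹ j₁ == j₂)

HOM : BS → BS → BS → BS → BF
HOM VG EG VH EH = `exS λ Z →
  (`ex λ p → `ex λ q → IsPred ∣ VG ∣' p & IsPred ∣ VH ∣' q & ∣ Z ∣' ≤' ⟨ p , q ⟩) &
  MAP ∣ VG ∣' ∣ VH ∣' Z &
  all< ∣ VG ∣' (λ i₁ → all< ∣ VG ∣' λ i₂ → all< ∣ VH ∣' λ j₁ → all< ∣ VH ∣' λ j₂ →
    (EG ∋' ⟨ i₁ , i₂ ⟩ & Z ∋' ⟨ i₁ , j₁ ⟩ & Z ∋' ⟨ i₂ , j₂ ⟩) ⟹ EH ∋' ⟨ j₁ , j₂ ⟩)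

BIP : BS → BS → BF
BIP VH EH = `exS λ W → `exS λ U →
  ∣ W ∣' ≤' ∣ VH ∣' & ∣ U ∣' ≤' ∣ VH ∣' &
  all< ∣ VH ∣' (λ i → W ∋' i ⟺ neg (U ∋' i)) &
  all< ∣ VH ∣' (λ j → all< j λ i → EH ∋' ⟨ i , j ⟩ ⟹
    (W ∋' i & U ∋' j) ∨' (W ∋' j & U ∋' i))

-- CYCLE(C_k), with p = k - 1
CYCLE : BN → BS → BF
CYCLE p E =
  E ∋' ⟨ `z , p ⟩ &
  all< p (λ i → E ∋' ⟨ i , i +' `o ⟩) &
  all< p (λ i → all< p λ j → neg (j == i +' `o) ⟹ neg (E ∋' ⟨ i , j ⟩))

NONBIP : BS → BS → BF
NONBIP VG EG = ex≤ ∣ VG ∣' λ k → `ex λ p → IsPred k p &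
  Divides two p &
  (`exS λ Vc → ∣ Vc ∣' == k &
    (`exS λ Ec → ∣ Ec ∣' <' four ·' (k ·' k) &
      CYCLE p Ec & HOM Vc Ec VG EG))

Theorem2Sentence : Form
Theorem2Sentence = closed
  (`allS λ VG → `allS λ EG → `allS λ VH → `allS λ EH →
     (IsGraph VG EG & IsGraph VH EH) ⟹
     ((BIP VH EH & NONBIP VG EG) ⟹ neg (HOM VG EG VH EH)))

module Submission where

-- NONBIP(G) provides a cycle C on the vertices 0..P with P = 2z and a
-- homomorphism zf : C → G; let zg : G → H be the assumed homomorphism and (W, U)
-- the bipartition of H.  Composing, each cycle edge goes to an edge of H, and an
-- edge of H leads from W into U and from U into W.  So if vertex 0 is sent into
-- W, the vertex 2m is sent into W for every m ≤ z, in particular vertex P; but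
-- (0, P) is a cycle edge, so the image of P would lie in both W and U.
-- V^0 has no induction axiom; the induction over m is obtained from Σ^B_0-COMP
-- by taking the largest element of {m ≤ z : vertex 2m is sent into W}.

open import Defs
open import Data.Nat using (ℕ; suc; _+_)
open import Data.List using (List; []; _∷_; _++_; map; length; lookup)
open import Data.List.Relation.Unary.All using (All; []; _∷_)
open import Data.List.Membership.Propositional.Properties using (∈-lookup)
open import Data.List.Relation.Binary.Subset.Propositional using (_⊆_)
open import Data.List.Relation.Binary.Subset.Propositional.Properties using (map⁺; ∷⁺ʳ; xs⊆ys++xs; ++⁺ʳ)
open import Data.List.Relation.Unary.Any using (there)
open import Data.Fin using (Fin; #_)
open import Relation.Binary.PropositionalEquality using (_≡_; refl; subst; cong; cong₂; sym)

variable
  Γ : List Form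

wk : ∀ {Γ Δ φ} → Γ ⊆ Δ → Γ ⊢V0 φ → Δ ⊢V0 φ
wk s (hyp p) = hyp (s p)
wk s (ax a) = ax a
wk s (raa d) = raa (wk (∷⁺ʳ _ s) d)
wk s (⇒I d) = ⇒I (wk (∷⁺ʳ _ s) d)
wk s (⇒E d e) = ⇒E (wk s d) (wk s e)
wk s (∧I d e) = ∧I (wk s d) (wk s e)
wk s (∧E₁ d) = ∧E₁ (wk s d)
wk s (∧E₂ d) = ∧E₂ (wk s d)
wk s (∨I₁ d) = ∨I₁ (wk s d)
wk s (∨I₂ d) = ∨I₂ (wk s d)
wk s (∨E d e f) = ∨E (wk s d) (wk (∷⁺ʳ _ s) e) (wk (∷⁺ʳ _ s) f)
wk s (∀nI d) = ∀nI (wk (map⁺ ↑n s) d)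
wk s (∀nE t d) = ∀nE t (wk s d)
wk s (∃nI t d) = ∃nI t (wk s d)
wk s (∃nE d e) = ∃nE (wk s d) (wk (∷⁺ʳ _ (map⁺ ↑n s)) e)
wk s (∀sI d) = ∀sI (wk (map⁺ ↑s s) d)
wk s (∀sE j d) = ∀sE j (wk s d)
wk s (∃sI j d) = ∃sI j (wk s d)
wk s (∃sE d e) = ∃sE (wk s d) (wk (∷⁺ʳ _ (map⁺ ↑s s)) e)
wk s (reflN t) = reflN t
wk s (substN d e) = substN (wk s d) (wk s e)
wk s (reflS j) = reflS j
wk s (substS d e) = substS (wk s d) (wk s e)

wk₁ : ∀ {A φ} → Γ ⊢V0 φ → (A ∷ Γ) ⊢V0 φ
wk₁ = wk there

v : (i : Fin (length Γ)) → Γ ⊢V0 lookup Γ i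
v i = hyp (∈-lookup i)

cut : ∀ {A C} → Γ ⊢V0 A → (A ∷ Γ) ⊢V0 C → Γ ⊢V0 C
cut d e = ⇒E (⇒I e) d

-- Used to move derivations into the context
-- before an ∃-elimination, which shifts the context but not derivations.
discharge : ∀ {Φ ψ} → All (Γ ⊢V0_) Φ → (Φ ++ Γ) ⊢V0 ψ → Γ ⊢V0 ψ
discharge []                       k = k
discharge {Γ} {φ ∷ Φ} (d ∷ ds) k = discharge ds (cut (wk (xs⊆ys++xs Γ Φ) d) k)

efq : ∀ {A} → Γ ⊢V0 ⊥f → Γ ⊢V0 A
efq d = raa (wk₁ d)

⇔E₁ : ∀ {A B} → Γ ⊢V0 A ⇔f B → Γ ⊢V0 A → Γ ⊢V0 B
⇔E₁ p q = ⇒E (∧E₁ p) q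

⇔E₂ : ∀ {A B} → Γ ⊢V0 A ⇔f B → Γ ⊢V0 B → Γ ⊢V0 A
⇔E₂ p q = ⇒E (∧E₂ p) q

cases : ∀ {A C} → (A ∷ Γ) ⊢V0 C → (¬f A ∷ Γ) ⊢V0 C → Γ ⊢V0 C
cases d₁ d₂ =
  raa (⇒E (v (# 0)) (⇒E (⇒I (wk (∷⁺ʳ _ there) d₂))
                        (⇒I (⇒E (v (# 1)) (wk (∷⁺ʳ _ there) d₁)))))

∨-comm : ∀ {A B} → Γ ⊢V0 A ∨f B → Γ ⊢V0 B ∨f A
∨-comm d = ∨E d (∨I₂ (v (# 0))) (∨I₁ (v (# 0)))

sub-up : ∀ t x → subN (inst t) (↑t x) ≡ x
sub-up t (nvar k)       = refl
sub-up t `0             = refl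
sub-up t `1             = refl
sub-up t (x ⊕ y)        = cong₂ _⊕_ (sub-up t x) (sub-up t y)
sub-up t (x ⊗ y)        = cong₂ _⊗_ (sub-up t x) (sub-up t y)
sub-up t (len (svar j)) = refl

cast : ∀ {A B} → A ≡ B → Γ ⊢V0 A → Γ ⊢V0 B
cast {Γ} e d = subst (Γ ⊢V0_) e d

rewr : (φ : Form) (F : NTm → Form) → (∀ t → φ [ t ]n ≡ F t) →
       ∀ {t u} → Γ ⊢V0 t ≐ u → Γ ⊢V0 F t → Γ ⊢V0 F u
rewr φ F e {t} {u} d p = cast (e u) (substN {φ = φ} d (cast (sym (e t)) p))

introVar : ∀ {C} t → ((nvar 0 ≐ ↑t t) ∷ map ↑n Γ) ⊢V0 ↑n C → Γ ⊢V0 C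
introVar t d = ∃nE (∃nI t (cast (cong (t ≐_) (sym (sub-up t t))) (reflN t))) d

basic# : (k : Fin (length basicAxioms)) → Γ ⊢V0 lookup basicAxioms k
basic# k = ax (basic (∈-lookup k))

axB3 : ∀ x → Γ ⊢V0 x ⊕ `0 ≐ x
axB3 x = ∀nE x (basic# (# 2))

axB4 : ∀ x y → Γ ⊢V0 x ⊕ (y ⊕ `1) ≐ (x ⊕ y) ⊕ `1
axB4 {Γ} x y = subst (λ u → Γ ⊢V0 u ⊕ (y ⊕ `1) ≐ (u ⊕ y) ⊕ `1) (sub-up y x)
                 (∀nE y (∀nE x (basic# (# 3))))

axB5 : ∀ x → Γ ⊢V0 x ⊗ `0 ≐ `0
axB5 x = ∀nE x (basic# (# 4))

axB6 : ∀ x y → Γ ⊢V0 x ⊗ (y ⊕ `1) ≐ (x ⊗ y) ⊕ x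
axB6 {Γ} x y = subst (λ u → Γ ⊢V0 u ⊗ (y ⊕ `1) ≐ (u ⊗ y) ⊕ u) (sub-up y x)
                 (∀nE y (∀nE x (basic# (# 5))))

axB7 : ∀ x y → Γ ⊢V0 (x ≼ y ∧f y ≼ x) ⇒f (x ≐ y)
axB7 {Γ} x y = subst (λ u → Γ ⊢V0 (u ≼ y ∧f y ≼ u) ⇒f (u ≐ y)) (sub-up y x)
                 (∀nE y (∀nE x (basic# (# 6))))

axB8 : ∀ x y → Γ ⊢V0 x ≼ x ⊕ y
axB8 {Γ} x y = subst (λ u → Γ ⊢V0 u ≼ u ⊕ y) (sub-up y x) (∀nE y (∀nE x (basic# (# 7))))

axB9 : ∀ x → Γ ⊢V0 `0 ≼ x
axB9 x = ∀nE x (basic# (# 8))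

axB10 : ∀ x y → Γ ⊢V0 (x ≼ y) ∨f (y ≼ x)
axB10 {Γ} x y = subst (λ u → Γ ⊢V0 (u ≼ y) ∨f (y ≼ u)) (sub-up y x)
                  (∀nE y (∀nE x (basic# (# 9))))

axB11 : ∀ x y → Γ ⊢V0 (x ≼ y) ⇔f (x ≺ y ⊕ `1)
axB11 {Γ} x y = subst (λ u → Γ ⊢V0 (u ≼ y) ⇔f (u ≺ y ⊕ `1)) (sub-up y x)
                  (∀nE y (∀nE x (basic# (# 10))))

axB12 : ∀ x → Γ ⊢V0 ¬f (x ≐ `0) ⇒f ∃n ((nvar 0 ≼ ↑t x) ∧f (nvar 0 ⊕ `1 ≐ ↑t x))
axB12 x = ∀nE x (basic# (# 11))

axL1 : ∀ j y → Γ ⊢V0 (y ∈ₛ svar j) ⇒f (y ≺ len (svar j))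
axL1 j y = ∀nE y (∀sE j (basic# (# 12)))

axL2 : ∀ j y → Γ ⊢V0 (y ⊕ `1 ≐ len (svar j)) ⇒f (y ∈ₛ svar j)
axL2 j y = ∀nE y (∀sE j (basic# (# 13)))

eqSym : ∀ {x y} → Γ ⊢V0 x ≐ y → Γ ⊢V0 y ≐ x
eqSym {x = x} d = rewr (nvar 0 ≐ ↑t x) (_≐ x) (λ t → cong (t ≐_) (sub-up t x)) d (reflN x)

eqTrans : ∀ {x y z} → Γ ⊢V0 x ≐ y → Γ ⊢V0 y ≐ z → Γ ⊢V0 x ≐ z
eqTrans {x = x} d e = rewr (↑t x ≐ nvar 0) (x ≐_) (λ t → cong (_≐ t) (sub-up t x)) e d

sucCong : ∀ {x y} → Γ ⊢V0 x ≐ y → Γ ⊢V0 x ⊕ `1 ≐ y ⊕ `1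
sucCong {x = x} d =
  rewr (↑t x ⊕ `1 ≐ nvar 0 ⊕ `1) (λ t → x ⊕ `1 ≐ t ⊕ `1)
       (λ t → cong (λ u → u ⊕ `1 ≐ t ⊕ `1) (sub-up t x)) d (reflN (x ⊕ `1))

leR : ∀ {x y z} → Γ ⊢V0 y ≐ z → Γ ⊢V0 x ≼ y → Γ ⊢V0 x ≼ z
leR {x = x} d p = rewr (↑t x ≼ nvar 0) (x ≼_) (λ t → cong (_≼ t) (sub-up t x)) d p

leL : ∀ {x y z} → Γ ⊢V0 x ≐ z → Γ ⊢V0 x ≼ y → Γ ⊢V0 z ≼ y
leL {y = y} d p = rewr (nvar 0 ≼ ↑t y) (_≼ y) (λ t → cong (t ≼_) (sub-up t y)) d p

ltR : ∀ {x y z} → Γ ⊢V0 y ≐ z → Γ ⊢V0 x ≺ y → Γ ⊢V0 x ≺ z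
ltR {x = x} d p = rewr (↑t x ≺ nvar 0) (x ≺_) (λ t → cong (_≺ t) (sub-up t x)) d p

leRefl : ∀ x → Γ ⊢V0 x ≼ x
leRefl x = leR (axB3 x) (axB8 x `0)

antisym : ∀ {x y} → Γ ⊢V0 x ≼ y → Γ ⊢V0 y ≼ x → Γ ⊢V0 x ≐ y
antisym {x = x} {y = y} d e = ⇒E (axB7 x y) (∧I d e)

le⇒ltSuc : ∀ {x y} → Γ ⊢V0 x ≼ y → Γ ⊢V0 x ≺ y ⊕ `1
le⇒ltSuc {x = x} {y = y} d = ⇔E₁ (axB11 x y) d

ltSuc⇒le : ∀ {x y} → Γ ⊢V0 x ≺ y ⊕ `1 → Γ ⊢V0 x ≼ y
ltSuc⇒le {x = x} {y = y} d = ⇔E₂ (axB11 x y) d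

lt⇒ne : ∀ {x y} → Γ ⊢V0 x ≺ y → Γ ⊢V0 ¬f (y ≐ x)
lt⇒ne d = ⇒I (⇒E (wk₁ (∧E₂ d)) (eqSym (v (# 0))))

sucLe⇒lt : ∀ {x y} → Γ ⊢V0 x ⊕ `1 ≼ y → Γ ⊢V0 x ≺ y
sucLe⇒lt {Γ} {x} {y} d = ∧I le ne
  where
  le : Γ ⊢V0 x ≼ y
  le = ∨E (axB10 x y) (v (# 0))
         (efq (⇒E (∧E₂ (le⇒ltSuc (v (# 0))))
                  (eqSym (antisym (wk₁ d) (∧E₁ (le⇒ltSuc (v (# 0))))))))
  ne : Γ ⊢V0 ¬f (x ≐ y)
  ne = ⇒I (⇒E (∧E₂ (le⇒ltSuc (leRefl x)))
              (eqSym (antisym (leR (eqSym (v (# 0))) (wk₁ d)) (axB8 x `1))))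

lt⇒sucLe : ∀ {x y} → Γ ⊢V0 x ≺ y → Γ ⊢V0 x ⊕ `1 ≼ y
lt⇒sucLe {x = x} {y = y} d = ∨E (axB10 (x ⊕ `1) y) (v (# 0))
  (cases (leL (v (# 0)) (leRefl y))
         (efq (⇒E (wk₁ (wk₁ (∧E₂ d)))
                  (antisym (wk₁ (wk₁ (∧E₁ d))) (ltSuc⇒le (∧I (v (# 1)) (v (# 0))))))))

-- The objects of the theorem, as de Bruijn indices of string variables:
-- G = (vg, eg), H = (vh, eh), the homomorphism zg : G → H, the bipartition
-- (w, u) of H, the cycle C = (vc, ec) and the homomorphism zf : C → G.
record Names : Set where
  constructor names
  field vg eg vh eh zg w u vc ec zf : ℕ
open Names

shiftNames : Names → Names
shiftNames (names a b c d e f g h i j) =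
  names (suc a) (suc b) (suc c) (suc d) (suc e) (suc f) (suc g) (suc h) (suc i) (suc j)

swapColours : Names → Names
swapColours (names a b c d e f g h i j) = names a b c d e g f h i j

pair : NTm → NTm → NTm
pair x y = ((x ⊕ y) ⊗ ((x ⊕ y) ⊕ `1)) ⊕ ((`1 ⊕ `1) ⊗ y)

`2 : NTm
`2 = `1 ⊕ `1

Total : (dom cod Z : ℕ) → Form
Total dom cod Z = ∀n ((nvar 0 ≺ len (svar dom)) ⇒f
  ∃n ((nvar 0 ≺ len (svar cod)) ∧f (pair (nvar 1) (nvar 0) ∈ₛ svar Z)))

EdgePreserving : (dom cod E Z E' : ℕ) → Form
EdgePreserving dom cod E Z E' =
  ∀n ((nvar 0 ≺ len (svar dom)) ⇒f ∀n ((nvar 0 ≺ len (svar dom)) ⇒f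
  ∀n ((nvar 0 ≺ len (svar cod)) ⇒f ∀n ((nvar 0 ≺ len (svar cod)) ⇒f
    ((pair (nvar 3) (nvar 2) ∈ₛ svar E) ∧f
       ((pair (nvar 3) (nvar 1) ∈ₛ svar Z) ∧f (pair (nvar 2) (nvar 0) ∈ₛ svar Z))
     ⇒f (pair (nvar 1) (nvar 0) ∈ₛ svar E'))))))

module _ (s : Names) where
  VG VH VC : NTm
  VG = len (svar (vg s))
  VH = len (svar (vh s))
  VC = len (svar (vc s))

  -- The hypotheses on H and (W, U) given by IsGraph and BIP.
  Irreflexive Symmetric Complementary Bipartition TwoColouring : Form
  Irreflexive = ∀n ((nvar 0 ≺ VH) ⇒f ¬f (pair (nvar 0) (nvar 0) ∈ₛ svar (eh s)))
  Symmetric = ∀n ((nvar 0 ≺ VH) ⇒f ∀n ((nvar 0 ≺ nvar 1) ⇒f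
    ((pair (nvar 0) (nvar 1) ∈ₛ svar (eh s)) ⇔f (pair (nvar 1) (nvar 0) ∈ₛ svar (eh s)))))
  Complementary = ∀n ((nvar 0 ≺ VH) ⇒f ((nvar 0 ∈ₛ svar (w s)) ⇔f ¬f (nvar 0 ∈ₛ svar (u s))))
  Bipartition = ∀n ((nvar 0 ≺ VH) ⇒f ∀n ((nvar 0 ≺ nvar 1) ⇒f
    ((pair (nvar 0) (nvar 1) ∈ₛ svar (eh s)) ⇒f
      (((nvar 0 ∈ₛ svar (w s)) ∧f (nvar 1 ∈ₛ svar (u s))) ∨f
       ((nvar 1 ∈ₛ svar (w s)) ∧f (nvar 0 ∈ₛ svar (u s)))))))
  TwoColouring = Irreflexive ∧f (Symmetric ∧f (Complementary ∧f Bipartition))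

  Covers Disjoint Flips ColourClass : Form
  Covers = ∀n ((nvar 0 ≺ VH) ⇒f ((nvar 0 ∈ₛ svar (w s)) ∨f (nvar 0 ∈ₛ svar (u s))))
  Disjoint = ∀n ((nvar 0 ≺ VH) ⇒f ((nvar 0 ∈ₛ svar (w s)) ⇒f ¬f (nvar 0 ∈ₛ svar (u s))))
  Flips = ∀n ((nvar 0 ≺ VH) ⇒f ∀n ((nvar 0 ≺ VH) ⇒f
    ((pair (nvar 1) (nvar 0) ∈ₛ svar (eh s)) ⇒f ((nvar 1 ∈ₛ svar (w s)) ⇒f (nvar 0 ∈ₛ svar (u s))))))
  ColourClass = Disjoint ∧f Flips

  Homs : Form
  Homs = Total (vg s) (vh s) (zg s) ∧f (EdgePreserving (vg s) (vh s) (eg s) (zg s) (eh s) ∧f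
         (Total (vc s) (vg s) (zf s) ∧f EdgePreserving (vc s) (vg s) (ec s) (zf s) (eg s)))

  -- C is a cycle on the vertices 0..P with P = 2Z even (the number variables
  -- P and Z are de Bruijn indices): edges (0,P) and (i,i+1) for i < P.
  OddCycle : ℕ → ℕ → Form
  OddCycle P Z = (pair `0 (nvar P) ∈ₛ svar (ec s)) ∧f
    (∀n ((nvar 0 ≺ nvar (suc P)) ⇒f (pair (nvar 0) (nvar 0 ⊕ `1) ∈ₛ svar (ec s))) ∧f
    ((nvar P ⊕ `1 ≐ VC) ∧f (`2 ⊗ nvar Z ≐ nvar P)))

  -- Cycle vertex I (a number variable) is sent by zg ∘ zf into W.  The bounds
  -- a ≤ |VG|, b ≤ |VH| make the quantifiers bounded in the sense of Σ^B_0.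
  SentToW : ℕ → Form
  SentToW I = ∃n ((nvar 0 ≼ VG) ∧f ((nvar 0 ≺ VG) ∧f
    ∃n ((nvar 0 ≼ VH) ∧f ((nvar 0 ≺ VH) ∧f ((pair (nvar (suc (suc I))) (nvar 1) ∈ₛ svar (zf s)) ∧f
      ((pair (nvar 1) (nvar 0) ∈ₛ svar (zg s)) ∧f (nvar 0 ∈ₛ svar (w s))))))))

  -- The induction invariant Ψ(t): the cycle vertex 2t, if it is ≤ P, is sent into W.
  EvenInW : ℕ → NTm → Form
  EvenInW P t = ∀n ((nvar 0 ≼ nvar (suc P)) ⇒f ((nvar 0 ≐ `2 ⊗ ↑t t) ⇒f SentToW 0))

ProperColouring : Names → Form
ProperColouring s = ColourClass s ∧f ColourClass (swapColours s)

Setting : Names → ℕ → ℕ → Form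
Setting s P Z = ProperColouring s ∧f (Homs s ∧f OddCycle s P Z)

module UseSetting {s P Z} (h : Γ ⊢V0 Setting s P Z) where
  disjoint : Γ ⊢V0 Disjoint s
  disjoint = ∧E₁ (∧E₁ (∧E₁ h))
  flips : Γ ⊢V0 Flips s
  flips = ∧E₂ (∧E₁ (∧E₁ h))
  totalG : Γ ⊢V0 Total (vg s) (vh s) (zg s)
  totalG = ∧E₁ (∧E₁ (∧E₂ h))
  homG : Γ ⊢V0 EdgePreserving (vg s) (vh s) (eg s) (zg s) (eh s)
  homG = ∧E₁ (∧E₂ (∧E₁ (∧E₂ h)))
  totalC : Γ ⊢V0 Total (vc s) (vg s) (zf s)
  totalC = ∧E₁ (∧E₂ (∧E₂ (∧E₁ (∧E₂ h))))
  homC : Γ ⊢V0 EdgePreserving (vc s) (vg s) (ec s) (zf s) (eg s)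
  homC = ∧E₂ (∧E₂ (∧E₂ (∧E₁ (∧E₂ h))))
  lastEdge : Γ ⊢V0 pair `0 (nvar P) ∈ₛ svar (ec s)
  lastEdge = ∧E₁ (∧E₂ (∧E₂ h))
  cycleEdge : Γ ⊢V0 ∀n ((nvar 0 ≺ nvar (suc P)) ⇒f (pair (nvar 0) (nvar 0 ⊕ `1) ∈ₛ svar (ec s)))
  cycleEdge = ∧E₁ (∧E₂ (∧E₂ (∧E₂ h)))
  lastVertex : Γ ⊢V0 nvar P ⊕ `1 ≐ VC s
  lastVertex = ∧E₁ (∧E₂ (∧E₂ (∧E₂ (∧E₂ h))))
  half : Γ ⊢V0 `2 ⊗ nvar Z ≐ nvar P
  half = ∧E₂ (∧E₂ (∧E₂ (∧E₂ (∧E₂ h))))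

open UseSetting

swapSetting : ∀ {s P Z} → Γ ⊢V0 Setting s P Z → Γ ⊢V0 Setting (swapColours s) P Z
swapSetting h = ∧I (∧I (∧E₂ (∧E₁ h)) (∧E₁ (∧E₁ h))) (∧E₂ h)

homEdge : ∀ {dom cod E Z E'} (I I' J J' : ℕ) → Γ ⊢V0 EdgePreserving dom cod E Z E' →
          Γ ⊢V0 nvar I ≺ len (svar dom) → Γ ⊢V0 nvar I' ≺ len (svar dom) →
          Γ ⊢V0 nvar J ≺ len (svar cod) → Γ ⊢V0 nvar J' ≺ len (svar cod) →
          Γ ⊢V0 pair (nvar I) (nvar I') ∈ₛ svar E →
          Γ ⊢V0 pair (nvar I) (nvar J) ∈ₛ svar Z → Γ ⊢V0 pair (nvar I') (nvar J') ∈ₛ svar Z →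
          Γ ⊢V0 pair (nvar J) (nvar J') ∈ₛ svar E'
homEdge I I' J J' hom i i' j j' e z z' =
  ⇒E (⇒E (∀nE (nvar J') (⇒E (∀nE (nvar J) (⇒E (∀nE (nvar I') (⇒E (∀nE (nvar I) hom) i)) i')) j)) j')
     (∧I e (∧I z z'))

flipAt : ∀ {s} (B B' : ℕ) → Γ ⊢V0 Flips s → Γ ⊢V0 nvar B ≺ VH s → Γ ⊢V0 nvar B' ≺ VH s →
         Γ ⊢V0 pair (nvar B) (nvar B') ∈ₛ svar (eh s) → Γ ⊢V0 nvar B ∈ₛ svar (w s) →
         Γ ⊢V0 nvar B' ∈ₛ svar (u s)
flipAt B B' fl b b' e x = ⇒E (⇒E (⇒E (∀nE (nvar B') (⇒E (∀nE (nvar B) fl) b)) b') e) x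

disjointAt : ∀ {s} (B : ℕ) → Γ ⊢V0 Disjoint s → Γ ⊢V0 nvar B ≺ VH s →
             Γ ⊢V0 nvar B ∈ₛ svar (w s) → Γ ⊢V0 nvar B ∈ₛ svar (u s) → Γ ⊢V0 ⊥f
disjointAt B d b x y = ⇒E (⇒E (⇒E (∀nE (nvar B) d) b) x) y

belowLast : ∀ {s P Z x} → Γ ⊢V0 Setting s P Z → Γ ⊢V0 x ≼ nvar P → Γ ⊢V0 x ≺ VC s
belowLast h d = ltR (lastVertex h) (le⇒ltSuc d)

sentToW-intro : ∀ {s} (I A B : ℕ) → Γ ⊢V0 nvar A ≺ VG s → Γ ⊢V0 nvar B ≺ VH s →
                Γ ⊢V0 pair (nvar I) (nvar A) ∈ₛ svar (zf s) →
                Γ ⊢V0 pair (nvar A) (nvar B) ∈ₛ svar (zg s) →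
                Γ ⊢V0 nvar B ∈ₛ svar (w s) → Γ ⊢V0 SentToW s I
sentToW-intro I A B a b f g x =
  ∃nI (nvar A) (∧I (∧E₁ a) (∧I a (∃nI (nvar B) (∧I (∧E₁ b) (∧I b (∧I f (∧I g x)))))))

-- The facts about the witnesses a (nvar 1) and b (nvar 0) of SentToW s I,
-- stated in the context extended by a and b.
ImageFacts : Names → ℕ → List Form
ImageFacts s I = (nvar 0 ∈ₛ svar (w s)) ∷ (pair (nvar 1) (nvar 0) ∈ₛ svar (zg s)) ∷
  (pair (nvar (suc (suc I))) (nvar 1) ∈ₛ svar (zf s)) ∷ (nvar 0 ≺ VH s) ∷ (nvar 1 ≺ VG s) ∷ []

openSent : ∀ {s I ψ} → Γ ⊢V0 SentToW s I →
           (ImageFacts s I ++ map ↑n (map ↑n Γ)) ⊢V0 ↑n (↑n ψ) → Γ ⊢V0 ψ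
openSent {Γ} {s} {I} sent k =
  ∃nE sent (∃nE (∧E₂ (∧E₂ (v (# 0))))
    (discharge (∧E₂ (∧E₂ (∧E₂ (∧E₂ (v (# 0))))) ∷ ∧E₁ (∧E₂ (∧E₂ (∧E₂ (v (# 0))))) ∷
                ∧E₁ (∧E₂ (∧E₂ (v (# 0)))) ∷ ∧E₁ (∧E₂ (v (# 0))) ∷ ∧E₁ (∧E₂ (v (# 1))) ∷ [])
               (wk (++⁺ʳ (ImageFacts s I) (xs⊆ys++xs _ (_ ∷ _ ∷ []))) k)))

sentResp : ∀ {s I J} → Γ ⊢V0 nvar I ≐ nvar J → Γ ⊢V0 SentToW s I → Γ ⊢V0 SentToW s J
sentResp {s = s} eq d = substN {φ = SentToW s 0} eq d

module _ {s : Names} (tc : Γ ⊢V0 TwoColouring s) where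
  irreflexive : Γ ⊢V0 Irreflexive s
  irreflexive = ∧E₁ tc
  symmetric : Γ ⊢V0 Symmetric s
  symmetric = ∧E₁ (∧E₂ tc)
  complementary : Γ ⊢V0 Complementary s
  complementary = ∧E₁ (∧E₂ (∧E₂ tc))
  bipartition : Γ ⊢V0 Bipartition s
  bipartition = ∧E₂ (∧E₂ (∧E₂ tc))

Across : Names → ℕ → ℕ → Form
Across s B B' = ((nvar B ∈ₛ svar (w s)) ∧f (nvar B' ∈ₛ svar (u s))) ∨f
                ((nvar B' ∈ₛ svar (w s)) ∧f (nvar B ∈ₛ svar (u s)))

bipartitionAt : ∀ {s} (I J : ℕ) → Γ ⊢V0 TwoColouring s → Γ ⊢V0 nvar J ≺ VH s →
                Γ ⊢V0 nvar I ≺ nvar J → Γ ⊢V0 pair (nvar I) (nvar J) ∈ₛ svar (eh s) →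
                Γ ⊢V0 Across s I J
bipartitionAt {s = s} I J tc j ij e = ⇒E (⇒E (∀nE (nvar I) (⇒E (∀nE (nvar J) (bipartition {s = s} tc)) j)) ij) e

complementaryAt : ∀ {s} (B : ℕ) → Γ ⊢V0 TwoColouring s → Γ ⊢V0 nvar B ≺ VH s →
                  Γ ⊢V0 (nvar B ∈ₛ svar (w s)) ⇔f ¬f (nvar B ∈ₛ svar (u s))
complementaryAt {s = s} B tc b = ⇒E (∀nE (nvar B) (complementary {s = s} tc)) b

-- Every edge of H joins W to U, whatever the order of its end points:
-- irreflexivity excludes B = B', symmetry reduces B' < B to B < B'.
edgeAcross : ∀ {s} (B B' : ℕ) → Γ ⊢V0 TwoColouring s →
             Γ ⊢V0 nvar B ≺ VH s → Γ ⊢V0 nvar B' ≺ VH s →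
             Γ ⊢V0 pair (nvar B) (nvar B') ∈ₛ svar (eh s) → Γ ⊢V0 Across s B B'
edgeAcross {Γ} {s} B B' tc b b' e = cases {A = nvar B ≐ nvar B'}
  (efq (⇒E (⇒E (∀nE (nvar B) (irreflexive {s = s} (wk₁ tc))) (wk₁ b))
           (substN {φ = pair (nvar (suc B)) (nvar 0) ∈ₛ svar (eh s)} (eqSym (v (# 0))) (wk₁ e))))
  (∨E (axB10 (nvar B) (nvar B'))
      (bipartitionAt {s = s} B B' (wk₂ tc) (wk₂ b') (∧I (v (# 0)) (v (# 1))) (wk₂ e))
      (∨-comm (bipartitionAt {s = s} B' B (wk₂ tc) (wk₂ b) B'<B
                 (⇔E₂ (⇒E (∀nE (nvar B') (⇒E (∀nE (nvar B) (symmetric {s = s} (wk₂ tc))) (wk₂ b))) B'<B)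
                      (wk₂ e)))))
  where
  wk₂ : ∀ {A C φ} → Γ ⊢V0 φ → (A ∷ C ∷ Γ) ⊢V0 φ
  wk₂ = wk (λ p → there (there p))
  B'<B : ((nvar B' ≼ nvar B) ∷ ¬f (nvar B ≐ nvar B') ∷ Γ) ⊢V0 nvar B' ≺ nvar B
  B'<B = ∧I (v (# 0)) (⇒I (⇒E (v (# 2)) (eqSym (v (# 0)))))

properColouring : ∀ {s} → (TwoColouring s ∷ Γ) ⊢V0 ProperColouring s
properColouring {Γ} {s} = ∧I (∧I disjointWU flipsWU) (∧I disjointUW flipsUW)
  where
  disjointWU : (TwoColouring s ∷ Γ) ⊢V0 Disjoint s
  disjointUW : (TwoColouring s ∷ Γ) ⊢V0 Disjoint (swapColours s)
  flipsWU : (TwoColouring s ∷ Γ) ⊢V0 Flips s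
  flipsUW : (TwoColouring s ∷ Γ) ⊢V0 Flips (swapColours s)
  disjointWU = ∀nI (⇒I (∧E₁ (complementaryAt {s = s} 0 (v (# 1)) (v (# 0)))))
  disjointUW = ∀nI (⇒I (⇒I (⇒I (⇒E (⇒E (∧E₁ (complementaryAt {s = s} 0 (v (# 3)) (v (# 2)))) (v (# 0))) (v (# 1))))))
  flipsWU = ∀nI (⇒I (∀nI (⇒I (⇒I (⇒I
    (∨E (edgeAcross {s = s} 1 0 (v (# 4)) (v (# 3)) (v (# 2)) (v (# 1)))
        (∧E₂ (v (# 0)))
        (efq (⇒E (⇒E (∧E₁ (complementaryAt {s = s} 1 (v (# 5)) (v (# 4)))) (v (# 1))) (∧E₂ (v (# 0)))))))))))
  flipsUW = ∀nI (⇒I (∀nI (⇒I (⇒I (⇒I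
    (∨E (edgeAcross {s = s} 1 0 (v (# 4)) (v (# 3)) (v (# 2)) (v (# 1)))
        (efq (⇒E (⇒E (∧E₁ (complementaryAt {s = s} 1 (v (# 5)) (v (# 4)))) (∧E₁ (v (# 0)))) (v (# 1))))
        (∧E₁ (v (# 0)))))))))

-- Every vertex of H is in W or in U (classically, from W ↔ ¬U).
covers : ∀ {s} → (TwoColouring s ∷ Γ) ⊢V0 Covers s
covers {s = s} = ∀nI (⇒I (cases (∨I₁ (v (# 0)))
  (∨I₂ (raa (⇒E (v (# 1)) (⇔E₂ (complementaryAt {s = s} 0 (v (# 3)) (v (# 2))) (v (# 0))))))))

-- Choose a' = zf(I') and b' = zg(a'); the cycle
-- edge (I,I') is mapped to an edge (a,a') of G and then to an edge (b,b') of H,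
-- which leads from W into U.
flipStep : ∀ {s P Z} (I I' : ℕ) → Γ ⊢V0 Setting s P Z → Γ ⊢V0 SentToW s I →
           Γ ⊢V0 nvar I' ≐ nvar I ⊕ `1 → Γ ⊢V0 nvar I ≺ nvar P →
           Γ ⊢V0 SentToW (swapColours s) I'
flipStep {Γ} {s} {P} I I' h sent succ lt =
  discharge (sent ∷ edge ∷ I'∈C ∷ I∈C ∷ h ∷ [])
    -- b ∈ W, zg(a,b), zf(I,a), b < |VH|, a < |VG|, then the discharged facts
    (openSent {s = s} (v (# 0))
      (∃nE (⇒E (∀nE (nvar (2 + I')) (totalC (v (# 9)))) (v (# 7)))
        (∃nE (⇒E (∀nE (nvar 0) (totalG (v (# 10)))) (∧E₁ (v (# 0))))
          -- variables b' = 0, a' = 1, b = 2, a = 3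
          (sentToW-intro {s = swapColours s} (4 + I') 1 0 (∧E₁ (v (# 1))) (∧E₁ (v (# 0))) (∧E₂ (v (# 1))) (∧E₂ (v (# 0)))
            (flipAt {s = s} 2 0 (flips (v (# 11))) (v (# 5)) (∧E₁ (v (# 0)))
              (homEdge 3 1 2 0 (homG (v (# 11))) (v (# 6)) (∧E₁ (v (# 1))) (v (# 5)) (∧E₁ (v (# 0)))
                (homEdge (4 + I) (4 + I') 3 1 (homC (v (# 11))) (v (# 10)) (v (# 9))
                   (v (# 6)) (∧E₁ (v (# 1))) (v (# 8)) (v (# 4)) (∧E₂ (v (# 1))))
                (v (# 3)) (∧E₂ (v (# 0))))
              (v (# 2)))))))
  where
  edge : Γ ⊢V0 pair (nvar I) (nvar I') ∈ₛ svar (ec s)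
  edge = substN {φ = pair (nvar (suc I)) (nvar 0) ∈ₛ svar (ec s)} (eqSym succ)
                (⇒E (∀nE (nvar I) (cycleEdge h)) lt)
  I∈C : Γ ⊢V0 nvar I ≺ VC s
  I∈C = belowLast h (∧E₁ lt)
  I'∈C : Γ ⊢V0 nvar I' ≺ VC s
  I'∈C = belowLast h (leL (eqSym succ) (lt⇒sucLe lt))

-- Ψ(m) → Ψ(m+1): two steps along the cycle, from the vertex j₀ = 2m (sent
-- into W) via j₁ = 2m + 1 (sent into U) to i = 2m + 2 (sent into W again).
evenStep : ∀ {s P Z} (M : ℕ) → Γ ⊢V0 Setting s P Z → Γ ⊢V0 EvenInW s P (nvar M) →
           Γ ⊢V0 EvenInW s P (nvar M ⊕ `1)
evenStep {s = s} {P} M h ψ = discharge (ψ ∷ h ∷ []) (∀nI (⇒I (⇒I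
  (introVar (`2 ⊗ nvar (1 + M)) (introVar (nvar 0 ⊕ `1)
    -- context: j₁ = j₀ + 1, j₀ = 2m, i = 2(m+1), i ≤ P, Ψ(m), Setting;
    -- variables j₁ = 0, j₀ = 1, i = 2
    (flipStep 0 2 (swapSetting (v (# 5)))
      (flipStep 1 0 (v (# 5)) (⇒E (⇒E (∀nE (nvar 1) (v (# 4))) (∧E₁ j₀<P)) (v (# 1))) (v (# 0)) j₀<P)
      i=j₁+1 j₁<P))))))
  where
  Steps : List Form → List Form
  Steps Δ = (nvar 0 ≐ nvar 1 ⊕ `1) ∷ (nvar 1 ≐ `2 ⊗ nvar (3 + M)) ∷
            (nvar 2 ≐ `2 ⊗ (nvar (3 + M) ⊕ `1)) ∷ (nvar 2 ≼ nvar (3 + P)) ∷ Δ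
  -- 2(m+1) = (2m + 1) + 1 = (j₀ + 1) + 1 = j₁ + 1
  i=j₁+1 : ∀ {Δ} → Steps Δ ⊢V0 nvar 2 ≐ nvar 0 ⊕ `1
  i=j₁+1 = eqTrans (v (# 2)) (eqTrans (axB6 `2 (nvar (3 + M))) (eqTrans (axB4 (`2 ⊗ nvar (3 + M)) `1)
             (sucCong (eqTrans (sucCong (eqSym (v (# 1)))) (eqSym (v (# 0)))))))
  j₁<P : ∀ {Δ} → Steps Δ ⊢V0 nvar 0 ≺ nvar (3 + P)
  j₁<P = sucLe⇒lt (leL i=j₁+1 (v (# 3)))
  j₀<P : ∀ {Δ} → Steps Δ ⊢V0 nvar 1 ≺ nvar (3 + P)
  j₀<P = sucLe⇒lt (leL (v (# 0)) (∧E₁ j₁<P))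

σ-lt : ∀ x t → IsΣB0 (x ≺ t)
σ-lt x t = conj (leq x t) (impl (eqN x t) bot)

σ-SentToW : ∀ s I → IsΣB0 (SentToW s I)
σ-SentToW s I = bex (VG s) (conj (σ-lt _ _) (bex (VH s) (conj (σ-lt _ _)
                  (conj (mem _ _) (conj (mem _ _) (mem _ _))))))

σ-EvenInW : ∀ s P t → IsΣB0 (EvenInW s P t)
σ-EvenInW s P t = ball (nvar P) (impl (eqN _ _) (σ-SentToW s 0))

-- Induction for Ψ = EvenInW up to z, without an induction axiom.  By Σ^B_0-COMP
-- the set Y = {i < z + 1 : Ψ(i)} exists.  Ψ(0) makes Y non-empty, so |Y| = m + 1
-- with m ∈ Y (axioms B12, L2).  If m = z we are done; otherwise m + 1 < z + 1
-- and Ψ(m + 1) by evenStep, so m + 1 ∈ Y and m + 1 < |Y| (axiom L1): absurd.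
evenInduction : ∀ {s P Z} → Γ ⊢V0 Setting s P Z → Γ ⊢V0 EvenInW s P `0 →
                Γ ⊢V0 EvenInW s P (nvar Z)
evenInduction {Γ} {s} {P} {Z} h ψ₀ =
  raa (discharge (wk₁ h ∷ wk₁ ψ₀ ∷ [])
    (∃sE (∀nE (nvar Z ⊕ `1) (ax (comp (EvenInW s (suc P) (nvar 0)) (σ-EvenInW s (suc P) (nvar 0)))))
      -- context: Y as in Comprehension, Setting, Ψ(0), ¬ Ψ(z)
      (∃nE (⇒E (axB12 (len (svar 0))) (lt⇒ne (⇒E (axL1 0 `0) 0∈Y)))
        -- context: m as in Largest, then as before
        (cases {A = nvar 0 ≐ nvar (suc Z)}
          (⇒E (v (# 5)) (substN {φ = EvenInW s′ (2 + P) (nvar 0)} (v (# 0)) (wk₁ Ψm)))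
          (⇒E (∧E₂ (⇒E (axL1 0 (nvar 0 ⊕ `1)) m+1∈Y)) (∧E₂ (v (# 1))))))))
  where
  s′ : Names
  s′ = shiftNames s
  -- Y ⊆ [0, z + 1) consists exactly of the i with Ψ(i); Z, P are the current indices of z, P.
  Comprehension : ℕ → ℕ → Form
  Comprehension Z P = (len (svar 0) ≼ nvar Z ⊕ `1) ∧f
    ∀n ((nvar 0 ≺ nvar (suc Z) ⊕ `1) ⇒f ((nvar 0 ∈ₛ svar 0) ⇔f EvenInW s′ (suc P) (nvar 0)))
  Largest : Form
  Largest = (nvar 0 ≼ len (svar 0)) ∧f (nvar 0 ⊕ `1 ≐ len (svar 0))
  0∈Y : ∀ {Δ} → (Comprehension Z P ∷ Setting s′ P Z ∷ EvenInW s′ P `0 ∷ Δ) ⊢V0 `0 ∈ₛ svar 0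
  0∈Y = ⇔E₂ (⇒E (∀nE `0 (∧E₂ (v (# 0)))) (le⇒ltSuc (axB9 (nvar Z)))) (v (# 2))
  m<z+1 : ∀ {Δ} → (Largest ∷ Comprehension (suc Z) (suc P) ∷ Δ) ⊢V0 nvar 0 ≺ nvar (suc Z) ⊕ `1
  m<z+1 = sucLe⇒lt (leL (eqSym (∧E₂ (v (# 0)))) (∧E₁ (v (# 1))))
  Ψm : ∀ {Δ} → (Largest ∷ Comprehension (suc Z) (suc P) ∷ Δ) ⊢V0 EvenInW s′ (suc P) (nvar 0)
  Ψm = ⇔E₁ (⇒E (∀nE (nvar 0) (∧E₂ (v (# 1)))) m<z+1) (⇒E (axL2 0 (nvar 0)) (∧E₂ (v (# 0))))
  m+1∈Y : ∀ {Δ} → (¬f (nvar 0 ≐ nvar (suc Z)) ∷ Largest ∷ Comprehension (suc Z) (suc P) ∷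
                     Setting s′ (suc P) (suc Z) ∷ Δ) ⊢V0 (nvar 0 ⊕ `1) ∈ₛ svar 0
  m+1∈Y = ⇔E₂ (⇒E (∀nE (nvar 0 ⊕ `1) (∧E₂ (v (# 2))))
                  (le⇒ltSuc (lt⇒sucLe (∧I (ltSuc⇒le (wk₁ m<z+1)) (v (# 0))))))
               (evenStep 0 (v (# 3)) (wk₁ Ψm))

-- The closing edge (x, P), x = 0, of the cycle: if both end points are sent into
-- W, their images b, b' form an edge of H with b ∈ W, so b' ∈ U by Flips,
-- while b' ∈ W contradicts Disjoint.
closeCycle : ∀ {s P Z} (X : ℕ) → Γ ⊢V0 Setting s P Z → Γ ⊢V0 nvar X ≐ `0 →
             Γ ⊢V0 SentToW s X → Γ ⊢V0 SentToW s P → Γ ⊢V0 ⊥f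
closeCycle {Γ} {s} {P} X h x=0 sX sP =
  discharge (sX ∷ sP ∷ edge ∷ X∈C ∷ P∈C ∷ h ∷ [])
    (openSent {s = s} (v (# 0)) (openSent {s = s} (v (# 6))
      -- facts on b' = 0, a' = 1 (image of P), then on b = 2, a = 3 (image of x)
      (disjointAt {s = s} 0 (disjoint (v (# 15))) (v (# 3)) (v (# 0))
        (flipAt {s = s} 2 0 (flips (v (# 15))) (v (# 8)) (v (# 3))
          (homEdge 3 1 2 0 (homG (v (# 15))) (v (# 9)) (v (# 4)) (v (# 8)) (v (# 3))
            (homEdge (4 + X) (4 + P) 3 1 (homC (v (# 15))) (v (# 13)) (v (# 14))
               (v (# 9)) (v (# 4)) (v (# 12)) (v (# 7)) (v (# 2)))
            (v (# 6)) (v (# 1)))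
          (v (# 5))))))
  where
  edge : Γ ⊢V0 pair (nvar X) (nvar P) ∈ₛ svar (ec s)
  edge = substN {φ = pair (nvar 0) (nvar (suc P)) ∈ₛ svar (ec s)} (eqSym x=0) (lastEdge h)
  X∈C : Γ ⊢V0 nvar X ≺ VC s
  X∈C = belowLast h (leL (eqSym x=0) (axB9 (nvar P)))
  P∈C : Γ ⊢V0 nvar P ≺ VC s
  P∈C = belowLast h (leRefl (nvar P))

-- If the cycle vertex x = 0 is sent into W, then by induction so is P = 2z,
-- and the closing edge (0, P) gives a contradiction.
oddWalk : ∀ {s P Z} (X : ℕ) → Γ ⊢V0 Setting s P Z → Γ ⊢V0 nvar X ≐ `0 →
          Γ ⊢V0 SentToW s X → Γ ⊢V0 ⊥f
oddWalk {Γ} {s} {P} X h x=0 sX =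
  closeCycle X h x=0 sX
    (⇒E (⇒E (∀nE (nvar P) (evenInduction h Ψ0)) (leRefl (nvar P))) (eqSym (half h)))
  where
  -- Ψ(0): the vertex i = 2·0 equals x.
  Ψ0 : Γ ⊢V0 EvenInW s P `0
  Ψ0 = discharge (x=0 ∷ sX ∷ []) (∀nI (⇒I (⇒I
         (sentResp {s = s} (eqTrans (v (# 2)) (eqSym (eqTrans (v (# 0)) (axB5 `2)))) (v (# 3))))))

-- Start of the walk: cycle vertex 0 has an image b under zg ∘ zf.  If b ∈ W,
-- walk with the colour classes (W, U); if b ∈ U, with the classes exchanged.
startWalk : ∀ {s P Z} → Γ ⊢V0 Covers s → Γ ⊢V0 Setting s P Z → Γ ⊢V0 ⊥f
startWalk {s = s} {P} cov h = discharge (cov ∷ h ∷ [])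
  (∃nE (⇒E (∀nE `0 (totalC (v (# 1)))) (belowLast (v (# 1)) (axB9 (nvar P))))
    (∃nE (⇒E (∀nE (nvar 0) (totalG (v (# 2)))) (∧E₁ (v (# 0))))
      (introVar `0
        -- context: x = 0, b < |VH| ∧ zg(a,b), a < |VG| ∧ zf(0,a), Covers, Setting;
        -- variables x = 0, b = 1, a = 2
        (∨E (⇒E (∀nE (nvar 1) (v (# 3))) (∧E₁ (v (# 1))))
          (oddWalk 0 (v (# 5)) (v (# 1))
            (sentToW-intro {s = s} 0 2 1 (∧E₁ (v (# 3))) (∧E₁ (v (# 2))) x↦a (∧E₂ (v (# 2))) (v (# 0))))
          (oddWalk 0 (swapSetting (v (# 5))) (v (# 1))
            (sentToW-intro {s = swapColours s} 0 2 1 (∧E₁ (v (# 3))) (∧E₁ (v (# 2))) x↦a (∧E₂ (v (# 2))) (v (# 0))))))))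
  where
  x↦a : ∀ {Δ A B C} → (A ∷ (nvar 0 ≐ `0) ∷ B ∷ (C ∧f (pair `0 (nvar 2) ∈ₛ svar (zf s))) ∷ Δ) ⊢V0
                          pair (nvar 0) (nvar 2) ∈ₛ svar (zf s)
  x↦a = substN {φ = pair (nvar 0) (nvar 3) ∈ₛ svar (zf s)} (eqSym (v (# 1))) (∧E₂ (v (# 3)))

noHom : ∀ {s P Z} → Γ ⊢V0 TwoColouring s → Γ ⊢V0 Homs s → Γ ⊢V0 OddCycle s P Z → Γ ⊢V0 ⊥f
noHom {s = s} tc homs cyc =
  startWalk (cut tc (covers {s = s})) (∧I (cut tc (properColouring {s = s})) (∧I homs cyc))

-- A cycle with k = 0 vertices cannot exist: its edge set would satisfy |Ec| < 4·(0·0) = 0.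
`4 : NTm
`4 = ((`1 ⊕ `1) ⊕ `1) ⊕ `1

noEmptyCycle : (K j : ℕ) → Γ ⊢V0 nvar K ≐ `0 →
               Γ ⊢V0 len (svar j) ≺ `4 ⊗ (nvar K ⊗ nvar K) → Γ ⊢V0 ⊥f
noEmptyCycle {Γ} K j k=0 bound = ⇒E (∧E₂ below0) (antisym (∧E₁ below0) (axB9 (len (svar j))))
  where
  below0 : Γ ⊢V0 len (svar j) ≺ `0
  below0 = ltR (axB5 `4)
             (substN {φ = len (svar j) ≺ `4 ⊗ nvar 0} (axB5 `0)
               (substN {φ = len (svar j) ≺ `4 ⊗ (nvar 0 ⊗ nvar 0)} k=0 bound))

theorem2 : V0⊢ Theorem2Sentence
theorem2 = ∀sI (∀sI (∀sI (∀sI (⇒I (⇒I (⇒I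
  -- unpack HOM(G,H): zg; BIP(H): W, U; NONBIP(G): k, p = k - 1, z with 2z = p,
  -- the cycle (Vc, Ec) and the homomorphism zf from it to G
  (∃sE (v (# 0)) (∃sE (∧E₁ (v (# 2))) (∃sE (v (# 0))
   (∃nE (∧E₂ (v (# 4))) (∃nE (∧E₂ (v (# 0))) (∃nE (∧E₁ (∧E₂ (v (# 0))))
   (∃sE (∧E₂ (∧E₂ (v (# 1)))) (∃sE (∧E₂ (v (# 0))) (∃sE (∧E₂ (∧E₂ (v (# 0))))
     -- k = 0 (and p = 0), or p + 1 = k
     (∨E (∧E₁ (v (# 4)))
       (noEmptyCycle 2 1 (∧E₁ (v (# 0))) (∧E₁ (v (# 2))))
       (noHom {s = names 9 8 7 6 5 4 3 2 1 0} {P = 1} {Z = 0}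
         (∧I (∧E₂ (∧E₂ (∧E₂ (v (# 12))))) (∧I (∧E₁ (∧E₂ (∧E₂ (v (# 12)))))
           (∧I (∧E₁ (∧E₂ (∧E₂ (v (# 7))))) (∧E₂ (∧E₂ (∧E₂ (v (# 7))))))))
         (∧I (∧E₁ (∧E₁ (∧E₂ (v (# 9))))) (∧I (∧E₂ (∧E₂ (v (# 9))))
           (∧I (∧E₁ (∧E₁ (∧E₂ (v (# 1))))) (∧E₂ (∧E₂ (v (# 1)))))))
         (∧I (∧E₁ (∧E₁ (∧E₂ (v (# 2))))) (∧I (∧E₁ (∧E₂ (∧E₁ (∧E₂ (v (# 2))))))
           (∧I (eqTrans (v (# 0)) (eqSym (∧E₁ (v (# 3))))) (∧E₂ (v (# 4)))))))))))))))))))))))
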